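{- Let $\mathcal M$ be a faithful maniplex of rank $3$. If $\mathcal M$ is thin, then $\mathcal M$ is polytopal.
   Context: $[n]=\{0,\dots,n-1\}$. An $n$-maniplex is a finite simple connected $n$-valent graph with a proper edge-colouring by $[n]$ such that, whenever $|i-j|>1$, every connected subgraph induced by edges of colours $i$ and $j$ is a $4$-cycle. Vertices are flags; flags joined by a colour-$i$ edge are $i$-adjacent. An $i$-face ($i\in[n]$) is a connected component of the subgraph obtained by deleting all edges of colour $i$; there are also two improper faces of ranks $-1$ and $n$ incident to all faces. $\mathrm{Pos}(\mathcal M)$ is the set of faces ordered by $F\le G$ iff $F\cap G\ne\emptyset$ and $\mathrm{rank}F\le\mathrm{rank}G$; it is a flagged poset of rank $n$. $\mathcal M$ is thin if for every $i\in[n]$ and every incident pair $F_{i-1}\le F_{i+1}$ of ranks $i-1,i+1$ in $\mathrm{Pos}(\mathcal M)$ there are exactly two rank-$i$ elements between them. $\mathcal M$ is faithful if for every flag $\Phi$ the intersection of all faces of ranks $0,\dots,n-1$ containing $\Phi$ is $\{\Phi\}$. Maximal chains are $i$-adjacent if they differ only in rank $i$; a flagged poset is strongly connected if any two maximal chains $\Phi,\Psi$ are joined by a sequence of maximal chains, each containing $\Phi\cap\Psi$, consecutive ones being $i$-adjacent for some $i$. $\mathcal M$ is polytopal if $\mathrm{Pos}(\mathcal M)$ is thin and strongly connected (an abstract polytope). -}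

module Defs where

open import Data.Nat using (ℕ; zero; suc; _≤_; _<_; ∣_-_∣)
open import Data.Fin using (Fin; toℕ)
import Data.Fin as Fin
open import Data.Product using (Σ; ∃; _×_; _,_)
open import Data.Sum using (_⊎_)
open import Data.Unit using (⊤)
open import Relation.Binary.PropositionalEquality using (_≡_; _≢_)
open import Relation.Nullary using (¬_)

data Reach {n m : ℕ} (r : Fin n → Fin m → Fin m) (A : Fin n → Set)
           : Fin m → Fin m → Set where
  here : ∀ {x} → Reach r A x x
  step : ∀ {x y} (j : Fin n) → A j → Reach r A (r j x) y → Reach r A x y

-- Since the
-- graph is n-valent and properly edge-coloured by [n], every flag has
-- exactly one colour-i edge; r i x is the flag i-adjacent to x.

record Maniplex (n : ℕ) : Set where
  field
    m         : ℕ
    r         : Fin n → Fin m → Fin m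
    invol     : ∀ i x → r i (r i x) ≡ x
    noLoop    : ∀ i x → r i x ≢ x
    -- simple graph: no two edges of distinct colours join the same flags
    simple    : ∀ i j x → i ≢ j → r i x ≢ r j x
    connected : ∀ x y → Reach r (λ _ → ⊤) x y
    -- |i - j| > 1 : the (i,j)-coloured component of x is the 4-cycle
    -- x, r i x, r j (r i x), r i (r j (r i x)), closed by a j-edge to x
    fourCycle : ∀ i j x → 1 < ∣ toℕ i - toℕ j ∣ →
                r j (r i (r j (r i x))) ≡ x

module _ {n : ℕ} (M : Maniplex n) where
  open Maniplex M

  Flag : Set
  Flag = Fin m

  -- Ranks -1,0,...,n are encoded by k : Fin (2 + n), k standing for rank
  -- (toℕ k - 1).  The faces of rank k-1 are the connected components of
  -- the graph with the colour (k-1) edges deleted.  For the improper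
  -- ranks -1 and n no colour is deleted, so (M being connected) there is
  -- exactly one such face, containing all flags.
  Rank : Set
  Rank = Fin (suc (suc n))

  Allowed : Rank → Fin n → Set
  Allowed k j = suc (toℕ j) ≢ toℕ k

  -- a face: its rank together with a flag it contains
  Face : Set
  Face = Rank × Flag

  rankOf : Face → Rank
  rankOf (k , _) = k

  _∈F_ : Flag → Face → Set
  x ∈F (k , y) = Reach r (Allowed k) y x

  SameFace : Face → Face → Set
  SameFace (k , x) (l , y) = (k ≡ l) × Reach r (Allowed k) x y

  _≤P_ : Face → Face → Set
  F ≤P G = (toℕ (rankOf F) ≤ toℕ (rankOf G)) × (∃ λ x → (x ∈F F) × (x ∈F G))

  prop : Fin n → Rank
  prop i = Fin.suc (Fin.inject₁ i)

  Faithful : Set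
  Faithful = ∀ (Φ Ψ : Flag) → (∀ (i : Fin n) → Ψ ∈F (prop i , Φ)) → Ψ ≡ Φ

  Between : Fin n → Face → Face → Face → Set
  Between i F G H = (toℕ (rankOf H) ≡ suc (toℕ i)) × (F ≤P H) × (H ≤P G)

  Thin : Set
  Thin = ∀ (i : Fin n) (F G : Face) →
         toℕ (rankOf F) ≡ toℕ i → toℕ (rankOf G) ≡ suc (suc (toℕ i)) →
         F ≤P G →
         Σ Face λ H₁ → Σ Face λ H₂ →
           Between i F G H₁ × Between i F G H₂ × ¬ SameFace H₁ H₂ ×
           (∀ H → Between i F G H → SameFace H H₁ ⊎ SameFace H H₂)

  -- Pos(M) is a flagged poset, so its maximal chains are exactly the
  -- chains containing one face of every rank -1,...,n.  A maximal chain
  -- is given by a choice of face of each rank (via a flag in it), these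
  -- faces being pairwise incident.
  record MaxChain : Set where
    field
      at    : Rank → Flag
      chain : ∀ (k l : Rank) → toℕ k ≤ toℕ l → (k , at k) ≤P (l , at l)

  open MaxChain public

  faceAt : MaxChain → Rank → Face
  faceAt Φ k = (k , at Φ k)

  Adjacent : Rank → MaxChain → MaxChain → Set
  Adjacent k Φ Ψ = ¬ SameFace (faceAt Φ k) (faceAt Ψ k) ×
                   (∀ l → l ≢ k → SameFace (faceAt Φ l) (faceAt Ψ l))

  ContainsMeet : MaxChain → MaxChain → MaxChain → Set
  ContainsMeet Φ Ψ Λ = ∀ k → SameFace (faceAt Φ k) (faceAt Ψ k) →
                       SameFace (faceAt Λ k) (faceAt Φ k)

  SameChain : MaxChain → MaxChain → Set
  SameChain Φ Ψ = ∀ k → SameFace (faceAt Φ k) (faceAt Ψ k)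

  data ChainPath (P : MaxChain → Set) : MaxChain → MaxChain → Set where
    done : ∀ {Φ Ψ} → P Φ → SameChain Φ Ψ → ChainPath P Φ Ψ
    next : ∀ {Φ Λ Ψ} (k : Rank) → P Φ → Adjacent k Φ Λ →
           ChainPath P Λ Ψ → ChainPath P Φ Ψ

  StronglyConnected : Set
  StronglyConnected = ∀ (Φ Ψ : MaxChain) → ChainPath (ContainsMeet Φ Ψ) Φ Ψ

  Polytopal : Set
  Polytopal = Thin × StronglyConnected

{-# OPTIONS --safe #-}
-- Thinness at ranks 0 and 2 shows that 0- and 2-adjacent flags lie in different vertices and
-- facets; with the 4-cycles of colours 0, 2 this also separates 1-adjacent flags into different
-- edges. Thinness at rank 1 (the diamond) then says the edges between the vertex and facet of a
-- flag c are those of c and r₁ c, so every maximal chain consists of the faces of one flag.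
-- Two flags x, y are joined by a walk using only colours j whose j-faces of x and y differ: if x
-- and y share at most one proper face, walk inside it; if they share two, the diamond and the
-- 4-cycles force y = x or y = rⱼ x. The flag chains along such a walk contain every common face
-- and consecutive ones are adjacent, which is strong connectivity.
module Submission where

open import Defs
open import Data.Nat using (ℕ; zero; suc; _+_; _*_; _<_; z≤n; s≤s)
open import Data.Nat.Properties using (+-suc; m≤n⇒∃[o]m+o≡n; n<1+n; <-irrefl; suc-injective)
open import Data.Nat.DivMod using (_%_; _/_; m≡m%n+[m/n]*n; m%n<n)
open import Data.Fin using (Fin; zero; suc; toℕ; fromℕ; fromℕ<)
open import Data.Fin.Properties using (toℕ-injective; toℕ<n; toℕ-fromℕ; toℕ-inject₁; toℕ-fromℕ<; pigeonhole; any?; _≟_)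
open import Data.Product using (∃; _,_; proj₁; proj₂)
open import Data.Sum using (_⊎_; inj₁; inj₂)
import Data.Sum as Sum
open import Data.Unit using (⊤)
open import Data.Empty using (⊥-elim)
open import Relation.Binary.PropositionalEquality
open import Relation.Nullary using (¬_; Dec; yes; no)
open import Relation.Nullary.Decidable using (_⊎-dec_)

module _ {n m : ℕ} {r : Fin n → Fin m → Fin m} where

  Reach-trans : ∀ {B x y z} → Reach r B x y → Reach r B y z → Reach r B x z
  Reach-trans here q = q
  Reach-trans (step j b p) q = step j b (Reach-trans p q)

  Reach-snoc : ∀ {B x y} j → B j → Reach r B x y → Reach r B x (r j y)
  Reach-snoc j b p = Reach-trans p (step j b here)

  Reach-map : ∀ {B C} → (∀ j → B j → C j) → ∀ {x y} → Reach r B x y → Reach r C x y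
  Reach-map f here = here
  Reach-map f (step j b p) = step j (f j b) (Reach-map f p)

  Reach-closed : ∀ {B} (Q : Fin m → Set) → (∀ j y → B j → Q y → Q (r j y)) →
                 ∀ {x y} → Q x → Reach r B x y → Q y
  Reach-closed Q closed qx here = qx
  Reach-closed Q closed qx (step j b p) = Reach-closed Q closed (closed j _ b qx) p

  module _ (invol : ∀ j x → r j (r j x) ≡ x) where

    Reach-sym : ∀ {B x y} → Reach r B x y → Reach r B y x
    Reach-sym here = here
    Reach-sym {x = x} (step j b p) =
      Reach-trans (Reach-sym p) (subst (Reach r _ (r j x)) (invol j x) (step j b here))

module Faces {n : ℕ} (M : Maniplex n) where
  open Maniplex M

  infix 4 _∼[_]_

  _∼[_]_ : Flag M → Rank M → Flag M → Set
  x ∼[ k ] y = Reach r (Allowed M k) x y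

  ∼-sym : ∀ {k x y} → x ∼[ k ] y → y ∼[ k ] x
  ∼-sym = Reach-sym invol

  ∼-bottom : ∀ x y → x ∼[ zero ] y
  ∼-bottom x y = Reach-map (λ _ _ ()) (connected x y)

  ∼-top : ∀ x y → x ∼[ fromℕ (suc n) ] y
  ∼-top x y = Reach-map top-allowed (connected x y)
    where
      top-allowed : ∀ j → ⊤ → Allowed M (fromℕ (suc n)) j
      top-allowed j _ eq = <-irrefl (suc-injective (trans eq (toℕ-fromℕ (suc n)))) (toℕ<n j)

  sameFace-refl : ∀ {F} → SameFace M F F
  sameFace-refl = refl , here

  sameFace-sym : ∀ {F G} → SameFace M F G → SameFace M G F
  sameFace-sym (refl , p) = refl , ∼-sym p

  sameFace-trans : ∀ {F G H} → SameFace M F G → SameFace M G H → SameFace M F H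
  sameFace-trans (refl , p) (refl , q) = refl , Reach-trans p q

  ≢prop⇒Allowed : ∀ {k} j → k ≢ prop M j → Allowed M k j
  ≢prop⇒Allowed j k≢prop eq = k≢prop (toℕ-injective (trans (sym eq) (cong suc (sym (toℕ-inject₁ j)))))

  module _ (thin : Thin M) {i : Fin n} {F G : Face M}
           (rank-F : toℕ (rankOf M F) ≡ toℕ i) (rank-G : toℕ (rankOf M G) ≡ suc (suc (toℕ i)))
           (F≤G : _≤P_ M F G) where

    Thin⇒¬between-unique : ∀ K → ¬ (∀ H → Between M i F G H → SameFace M H K)
    Thin⇒¬between-unique K unique with thin i F G rank-F rank-G F≤G
    ... | H₁ , H₂ , between₁ , between₂ , H₁≉H₂ , _ =
      H₁≉H₂ (sameFace-trans (unique H₁ between₁) (sameFace-sym (unique H₂ between₂)))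

    Thin⇒between-dichotomy : ∀ {K L} → Between M i F G K → Between M i F G L → ¬ SameFace M K L →
                             ∀ H → Between M i F G H → SameFace M H K ⊎ SameFace M H L
    Thin⇒between-dichotomy {K} {L} between-K between-L K≉L H between-H
      with thin i F G rank-F rank-G F≤G
    ... | H₁ , H₂ , _ , _ , _ , two = sort (two K between-K) (two L between-L) (two H between-H)
      where
        sort : SameFace M K H₁ ⊎ SameFace M K H₂ → SameFace M L H₁ ⊎ SameFace M L H₂ →
               SameFace M H H₁ ⊎ SameFace M H H₂ → SameFace M H K ⊎ SameFace M H L
        sort (inj₁ K₁) (inj₁ L₁) _ = ⊥-elim (K≉L (sameFace-trans K₁ (sameFace-sym L₁)))
        sort (inj₂ K₂) (inj₂ L₂) _ = ⊥-elim (K≉L (sameFace-trans K₂ (sameFace-sym L₂)))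
        sort (inj₁ K₁) (inj₂ L₂) (inj₁ H₁) = inj₁ (sameFace-trans H₁ (sameFace-sym K₁))
        sort (inj₁ K₁) (inj₂ L₂) (inj₂ H₂) = inj₂ (sameFace-trans H₂ (sameFace-sym L₂))
        sort (inj₂ K₂) (inj₁ L₁) (inj₁ H₁) = inj₂ (sameFace-trans H₁ (sameFace-sym L₁))
        sort (inj₂ K₂) (inj₁ L₁) (inj₂ H₂) = inj₁ (sameFace-trans H₂ (sameFace-sym K₂))

  flagChain : Flag M → MaxChain M
  flagChain x = record { at = λ _ → x ; chain = λ _ _ k≤l → k≤l , x , here , here }

  Separating : Set
  Separating = ∀ i x → ¬ x ∼[ prop M i ] r i x

  flagChain-adjacent : Separating → ∀ j x → Adjacent M (prop M j) (flagChain x) (flagChain (r j x))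
  flagChain-adjacent separating j x =
    (λ (_ , x∼x′) → separating j x x∼x′) , λ k k≢prop → refl , step j (≢prop⇒Allowed j k≢prop) here

  PreservesCommonFaces : Flag M → Flag M → Fin n → Set
  PreservesCommonFaces x y j = ∀ k → x ∼[ k ] y → Allowed M k j

  split⇒preservesCommonFaces : ∀ {x y} j → ¬ x ∼[ prop M j ] y → PreservesCommonFaces x y j
  split⇒preservesCommonFaces j x≁y k x∼y = ≢prop⇒Allowed j λ { refl → x≁y x∼y }

  CommonFacesWalk : Flag M → Flag M → Set
  CommonFacesWalk x y = Reach r (PreservesCommonFaces x y) x y

  splitColours⇒commonFacesWalk : ∀ {B x y} → (∀ j → B j → ¬ x ∼[ prop M j ] y) →
                                 Reach r B x y → CommonFacesWalk x y
  splitColours⇒commonFacesWalk split = Reach-map (λ j b → split⇒preservesCommonFaces j (split j b))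

  equalOrAdjacent⇒commonFacesWalk : Separating → ∀ {x y} j → y ≡ x ⊎ y ≡ r j x → CommonFacesWalk x y
  equalOrAdjacent⇒commonFacesWalk separating j (inj₁ refl) = here
  equalOrAdjacent⇒commonFacesWalk separating {x} j (inj₂ refl) =
    step j (split⇒preservesCommonFaces j (separating j x)) here

  flagChainPath : Separating → ∀ {x y} → CommonFacesWalk x y →
                  ChainPath M (ContainsMeet M (flagChain x) (flagChain y)) (flagChain x) (flagChain y)
  flagChainPath separating {x} {y} = go here
    where
      containsMeet : ∀ {z} → Reach r (PreservesCommonFaces x y) x z →
                     ContainsMeet M (flagChain x) (flagChain y) (flagChain z)
      containsMeet walk k (_ , x∼y) = refl , ∼-sym (Reach-map (λ j preserves → preserves k x∼y) walk)

      go : ∀ {z} → Reach r (PreservesCommonFaces x y) x z → Reach r (PreservesCommonFaces x y) z y →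
           ChainPath M (ContainsMeet M (flagChain x) (flagChain y)) (flagChain z) (flagChain y)
      go walked here = done (containsMeet walked) (λ _ → sameFace-refl)
      go walked (step j preserves rest) =
        next (prop M j) (containsMeet walked) (flagChain-adjacent separating j _)
             (go (Reach-snoc j preserves walked) rest)

  module _ {P Q : MaxChain M → Set} where

    ChainPath-map : (∀ Λ → P Λ → Q Λ) → ∀ {Φ Ψ} → ChainPath M P Φ Ψ → ChainPath M Q Φ Ψ
    ChainPath-map f (done p Φ≈Ψ) = done (f _ p) Φ≈Ψ
    ChainPath-map f (next k p adjacent rest) = next k (f _ p) adjacent (ChainPath-map f rest)

  module _ {P : MaxChain M → Set} where

    ChainPath-respˡ : ∀ {Φ Φ′ Ψ} → SameChain M Φ Φ′ → P Φ → ChainPath M P Φ′ Ψ → ChainPath M P Φ Ψ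
    ChainPath-respˡ Φ≈Φ′ p (done _ Φ′≈Ψ) = done p (λ k → sameFace-trans (Φ≈Φ′ k) (Φ′≈Ψ k))
    ChainPath-respˡ Φ≈Φ′ p (next k _ (Φ′≉Λ , Φ′≈Λ) rest) =
      next k p ((λ Φ≈Λ → Φ′≉Λ (sameFace-trans (sameFace-sym (Φ≈Φ′ k)) Φ≈Λ)) ,
                λ l l≢k → sameFace-trans (Φ≈Φ′ l) (Φ′≈Λ l l≢k))
           rest

    ChainPath-respʳ : ∀ {Φ Ψ Ψ′} → SameChain M Ψ Ψ′ → ChainPath M P Φ Ψ → ChainPath M P Φ Ψ′
    ChainPath-respʳ Ψ≈Ψ′ (done p Φ≈Ψ) = done p (λ k → sameFace-trans (Φ≈Ψ k) (Ψ≈Ψ′ k))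
    ChainPath-respʳ Ψ≈Ψ′ (next k p adjacent rest) = next k p adjacent (ChainPath-respʳ Ψ≈Ψ′ rest)

  containsMeet-resp : ∀ {Φ Φ′ Ψ Ψ′} → SameChain M Φ Φ′ → SameChain M Ψ Ψ′ →
                      ∀ Λ → ContainsMeet M Φ′ Ψ′ Λ → ContainsMeet M Φ Ψ Λ
  containsMeet-resp Φ≈Φ′ Ψ≈Ψ′ Λ meet k Φ≈Ψ =
    sameFace-trans (meet k (sameFace-trans (sameFace-trans (sameFace-sym (Φ≈Φ′ k)) Φ≈Ψ) (Ψ≈Ψ′ k)))
                   (sameFace-sym (Φ≈Φ′ k))

  flagWalks⇒stronglyConnected : Separating → (∀ Φ → ∃ λ x → SameChain M Φ (flagChain x)) →
                                (∀ x y → CommonFacesWalk x y) → StronglyConnected M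
  flagWalks⇒stronglyConnected separating flagged walk Φ Ψ with flagged Φ | flagged Ψ
  ... | x , Φ≈x | y , Ψ≈y =
    ChainPath-respˡ Φ≈x (λ _ _ → sameFace-refl)
      (ChainPath-respʳ (λ k → sameFace-sym (Ψ≈y k))
        (ChainPath-map (containsMeet-resp {Φ} {flagChain x} {Ψ} {flagChain y} Φ≈x Ψ≈y)
          (flagChainPath separating (walk x y))))

-- A walk in colours c, d from x meets exactly the flags ρᵏ x and r c (ρᵏ x), ρ = r d ∘ r c, with k
-- below the period of ρ at x. This makes the faces of a 3-maniplex decidable, which the constructive
-- case split on the faces shared by two flags requires.
module Dihedral {n m : ℕ} (r : Fin n → Fin m → Fin m) (invol : ∀ j x → r j (r j x) ≡ x)
                {B : Fin n → Set} {c d : Fin n} (B-c : B c) (B-d : B d)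
                (only-c-d : ∀ j → B j → j ≡ c ⊎ j ≡ d) where

  rotation : Fin m → Fin m
  rotation z = r d (r c z)

  rotate : ℕ → Fin m → Fin m
  rotate zero z = z
  rotate (suc k) z = rotation (rotate k z)

  rotate-+ : ∀ a b z → rotate (a + b) z ≡ rotate a (rotate b z)
  rotate-+ zero b z = refl
  rotate-+ (suc a) b z = cong rotation (rotate-+ a b z)

  rotation-injective : ∀ {a b} → rotation a ≡ rotation b → a ≡ b
  rotation-injective {a} {b} eq = begin
    a                          ≡⟨ sym (unrotate a) ⟩
    r c (r d (rotation a))     ≡⟨ cong (λ z → r c (r d z)) eq ⟩
    r c (r d (rotation b))     ≡⟨ unrotate b ⟩
    b                          ∎
    where
      open ≡-Reasoning
      unrotate : ∀ z → r c (r d (rotation z)) ≡ z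
      unrotate z = trans (cong (r c) (invol d _)) (invol c z)

  rotate-injective : ∀ k {a b} → rotate k a ≡ rotate k b → a ≡ b
  rotate-injective zero eq = eq
  rotate-injective (suc k) eq = rotate-injective k (rotation-injective eq)

  reach-rotate : ∀ k x → Reach r B x (rotate k x)
  reach-rotate zero x = here
  reach-rotate (suc k) x = Reach-snoc d B-d (Reach-snoc c B-c (reach-rotate k x))

  module _ (x : Fin m) where

    period : ∃ λ p → rotate (suc p) x ≡ x
    period with pigeonhole (n<1+n m) (λ i → rotate (toℕ i) x)
    ... | i , j , i<j , eq with m≤n⇒∃[o]m+o≡n i<j
    ... | p , i+1+p≡j = p , rotate-injective (toℕ i) (begin
      rotate (toℕ i) (rotate (suc p) x)  ≡⟨ sym (rotate-+ (toℕ i) (suc p) x) ⟩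
      rotate (toℕ i + suc p) x           ≡⟨ cong (λ k → rotate k x) (trans (+-suc (toℕ i) p) i+1+p≡j) ⟩
      rotate (toℕ j) x                   ≡⟨ sym eq ⟩
      rotate (toℕ i) x                   ∎)
      where open ≡-Reasoning

    p : ℕ
    p = proj₁ period

    rotate-mod : ∀ k → rotate k x ≡ rotate (k % suc p) x
    rotate-mod k = begin
      rotate k x                                   ≡⟨ cong (λ t → rotate t x) (m≡m%n+[m/n]*n k (suc p)) ⟩
      rotate (k % suc p + k / suc p * suc p) x     ≡⟨ rotate-+ (k % suc p) (k / suc p * suc p) x ⟩
      rotate (k % suc p) (rotate (k / suc p * suc p) x)  ≡⟨ cong (rotate (k % suc p)) (periodic (k / suc p)) ⟩
      rotate (k % suc p) x                         ∎
      where
        open ≡-Reasoning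
        periodic : ∀ q → rotate (q * suc p) x ≡ x
        periodic zero = refl
        periodic (suc q) =
          trans (rotate-+ (suc p) (q * suc p) x) (trans (cong (rotate (suc p)) (periodic q)) (proj₂ period))

    InOrbit : ℕ → Fin m → Set
    InOrbit k y = y ≡ rotate k x ⊎ y ≡ r c (rotate k x)

    inOrbit-closed : ∀ j y → B j → (∃ λ k → InOrbit k y) → ∃ λ k → InOrbit k (r j y)
    inOrbit-closed j y b o with only-c-d j b
    inOrbit-closed j y b (k , inj₁ refl) | inj₁ refl = k , inj₂ refl
    inOrbit-closed j y b (k , inj₂ refl) | inj₁ refl = k , inj₁ (invol c _)
    inOrbit-closed j y b (zero , inj₁ refl) | inj₂ refl =
      p , inj₂ (trans (cong (r d) (sym (proj₂ period))) (invol d _))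
    inOrbit-closed j y b (suc k , inj₁ refl) | inj₂ refl = k , inj₂ (invol d _)
    inOrbit-closed j y b (k , inj₂ refl) | inj₂ refl = suc k , inj₁ refl

    inOrbit-mod : ∀ {k y} → InOrbit k y → InOrbit (k % suc p) y
    inOrbit-mod {k} = Sum.map (λ e → trans e (rotate-mod k)) (λ e → trans e (cong (r c) (rotate-mod k)))

    reach? : ∀ y → Dec (Reach r B x y)
    reach? y with any? (λ (i : Fin (suc p)) → (y ≟ rotate (toℕ i) x) ⊎-dec (y ≟ r c (rotate (toℕ i) x)))
    ... | yes (i , inj₁ refl) = yes (reach-rotate (toℕ i) x)
    ... | yes (i , inj₂ refl) = yes (Reach-snoc c B-c (reach-rotate (toℕ i) x))
    ... | no ¬inOrbit = no λ x∼y → ¬inOrbit (bounded (Reach-closed _ inOrbit-closed (zero , inj₁ refl) x∼y))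
      where
        bounded : (∃ λ k → InOrbit k y) → ∃ λ (i : Fin (suc p)) → InOrbit (toℕ i) y
        bounded (k , o) = fromℕ< k%<p , subst (λ t → InOrbit t y) (sym (toℕ-fromℕ< k%<p)) (inOrbit-mod {k} o)
          where
            k%<p : k % suc p < suc p
            k%<p = m%n<n k (suc p)

pattern c₀ = zero
pattern c₁ = suc zero
pattern c₂ = suc (suc zero)

pattern bottom = zero
pattern vertex = suc zero
pattern edge = suc (suc zero)
pattern facet = suc (suc (suc zero))
pattern top = suc (suc (suc (suc zero)))

module Rank3 (M : Maniplex 3) where
  open Maniplex M
  open Faces M

  r₀ r₁ r₂ : Flag M → Flag M
  r₀ = r c₀
  r₁ = r c₁
  r₂ = r c₂

  r₀r₂-comm : ∀ x → r₂ (r₀ x) ≡ r₀ (r₂ x)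
  r₀r₂-comm x = begin
    r₂ (r₀ x)                       ≡⟨ sym (invol c₀ _) ⟩
    r₀ (r₀ (r₂ (r₀ x)))             ≡⟨ cong r₀ (sym (invol c₂ _)) ⟩
    r₀ (r₂ (r₂ (r₀ (r₂ (r₀ x)))))   ≡⟨ cong (λ z → r₀ (r₂ z)) (fourCycle c₀ c₂ x (s≤s (s≤s z≤n))) ⟩
    r₀ (r₂ x)                       ∎
    where open ≡-Reasoning

  AmongEdgeFlags : Flag M → Flag M → Set
  AmongEdgeFlags x y = y ≡ x ⊎ y ≡ r₀ x ⊎ y ≡ r₂ x ⊎ y ≡ r₂ (r₀ x)

  edge-flags : ∀ {x y} → x ∼[ edge ] y → AmongEdgeFlags x y
  edge-flags {x} = Reach-closed (AmongEdgeFlags x) closed (inj₁ refl)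
    where
      closed : ∀ j y → Allowed M edge j → AmongEdgeFlags x y → AmongEdgeFlags x (r j y)
      closed c₀ _ _ (inj₁ refl) = inj₂ (inj₁ refl)
      closed c₀ _ _ (inj₂ (inj₁ refl)) = inj₁ (invol c₀ x)
      closed c₀ _ _ (inj₂ (inj₂ (inj₁ refl))) = inj₂ (inj₂ (inj₂ (sym (r₀r₂-comm x))))
      closed c₀ _ _ (inj₂ (inj₂ (inj₂ refl))) = inj₂ (inj₂ (inj₁ (trans (cong r₀ (r₀r₂-comm x)) (invol c₀ _))))
      closed c₁ _ ¬allowed _ = ⊥-elim (¬allowed refl)
      closed c₂ _ _ (inj₁ refl) = inj₂ (inj₂ (inj₁ refl))
      closed c₂ _ _ (inj₂ (inj₁ refl)) = inj₂ (inj₂ (inj₂ refl))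
      closed c₂ _ _ (inj₂ (inj₂ (inj₁ refl))) = inj₁ (invol c₂ x)
      closed c₂ _ _ (inj₂ (inj₂ (inj₂ refl))) = inj₂ (inj₁ (invol c₂ _))

  vertex? : ∀ x y → Dec (x ∼[ vertex ] y)
  vertex? = Dihedral.reach? r invol {c = c₁} {d = c₂} (λ ()) (λ ()) colours
    where
      colours : ∀ j → Allowed M vertex j → j ≡ c₁ ⊎ j ≡ c₂
      colours c₀ ¬allowed = ⊥-elim (¬allowed refl)
      colours c₁ _ = inj₁ refl
      colours c₂ _ = inj₂ refl

  edge? : ∀ x y → Dec (x ∼[ edge ] y)
  edge? = Dihedral.reach? r invol {c = c₀} {d = c₂} (λ ()) (λ ()) colours
    where
      colours : ∀ j → Allowed M edge j → j ≡ c₀ ⊎ j ≡ c₂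
      colours c₀ _ = inj₁ refl
      colours c₁ ¬allowed = ⊥-elim (¬allowed refl)
      colours c₂ _ = inj₂ refl

  facet? : ∀ x y → Dec (x ∼[ facet ] y)
  facet? = Dihedral.reach? r invol {c = c₀} {d = c₁} (λ ()) (λ ()) colours
    where
      colours : ∀ j → Allowed M facet j → j ≡ c₀ ⊎ j ≡ c₁
      colours c₀ _ = inj₁ refl
      colours c₁ _ = inj₂ refl
      colours c₂ ¬allowed = ⊥-elim (¬allowed refl)

  module _ (thin : Thin M) where

    edge⊆vertex : ∀ {x z} → x ∼[ vertex ] r₀ x → x ∼[ edge ] z → x ∼[ vertex ] z
    edge⊆vertex x∼r₀x x∼z with edge-flags x∼z
    ... | inj₁ refl = here
    ... | inj₂ (inj₁ refl) = x∼r₀x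
    ... | inj₂ (inj₂ (inj₁ refl)) = step c₂ (λ ()) here
    ... | inj₂ (inj₂ (inj₂ refl)) = Reach-snoc c₂ (λ ()) x∼r₀x

    edge⊆facet : ∀ {x z} → x ∼[ facet ] r₂ x → x ∼[ edge ] z → x ∼[ facet ] z
    edge⊆facet {x} x∼r₂x x∼z with edge-flags x∼z
    ... | inj₁ refl = here
    ... | inj₂ (inj₁ refl) = step c₀ (λ ()) here
    ... | inj₂ (inj₂ (inj₁ refl)) = x∼r₂x
    ... | inj₂ (inj₂ (inj₂ refl)) = subst (x ∼[ facet ]_) (sym (r₀r₂-comm x)) (Reach-snoc c₀ (λ ()) x∼r₂x)

    vertex-separates : ∀ x → ¬ x ∼[ vertex ] r₀ x
    vertex-separates x x∼r₀x =
      Thin⇒¬between-unique thin {c₀} {bottom , x} {edge , x} refl refl (z≤n , x , here , here) (vertex , x) unique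
      where
        unique : ∀ H → Between M c₀ (bottom , x) (edge , x) H → SameFace M H (vertex , x)
        unique (vertex , h) (_ , _ , _ , z , h∼z , x∼z) = refl , Reach-trans h∼z (∼-sym (edge⊆vertex x∼r₀x x∼z))
        unique (bottom , _) (() , _)
        unique (suc (suc _) , _) (() , _)

    facet-separates : ∀ x → ¬ x ∼[ facet ] r₂ x
    facet-separates x x∼r₂x =
      Thin⇒¬between-unique thin {c₂} {edge , x} {top , x} refl refl (s≤s (s≤s z≤n) , x , here , here) (facet , x) unique
      where
        unique : ∀ H → Between M c₂ (edge , x) (top , x) H → SameFace M H (facet , x)
        unique (facet , h) (_ , (_ , z , x∼z , h∼z) , _) = refl , Reach-trans h∼z (∼-sym (edge⊆facet x∼r₂x x∼z))
        unique (bottom , _) (() , _)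
        unique (vertex , _) (() , _)
        unique (edge , _) (() , _)

    edge-separates : ∀ x → ¬ x ∼[ edge ] r₁ x
    edge-separates x x∼r₁x with edge-flags x∼r₁x
    ... | inj₁ r₁x≡x = noLoop c₁ x r₁x≡x
    ... | inj₂ (inj₁ r₁x≡r₀x) = simple c₁ c₀ x (λ ()) r₁x≡r₀x
    ... | inj₂ (inj₂ (inj₁ r₁x≡r₂x)) = simple c₁ c₂ x (λ ()) r₁x≡r₂x
    ... | inj₂ (inj₂ (inj₂ r₁x≡r₂r₀x)) =
      vertex-separates x (subst (x ∼[ vertex ]_) (trans (cong r₂ r₁x≡r₂r₀x) (invol c₂ _))
                                (Reach-snoc c₂ (λ ()) (step c₁ (λ ()) here)))

    separating : Separating
    separating c₀ = vertex-separates
    separating c₁ = edge-separates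
    separating c₂ = facet-separates

    diamond : ∀ {v f c e} → v ∼[ vertex ] c → f ∼[ facet ] c →
              _≤P_ M (vertex , v) (edge , e) → _≤P_ M (edge , e) (facet , f) →
              e ∼[ edge ] c ⊎ e ∼[ edge ] r₁ c
    diamond {v} {f} {c} {e} v∼c f∼c v≤e e≤f =
      Sum.map proj₂ proj₂
        (Thin⇒between-dichotomy thin {c₁} {vertex , v} {facet , f} refl refl (s≤s z≤n , c , v∼c , f∼c)
          between-c between-r₁c (λ (_ , c∼r₁c) → edge-separates c c∼r₁c) (edge , e) (refl , v≤e , e≤f))
      where
        between-c : Between M c₁ (vertex , v) (facet , f) (edge , c)
        between-c = refl , (s≤s z≤n , c , v∼c , here) , (s≤s (s≤s z≤n) , c , here , f∼c)

        between-r₁c : Between M c₁ (vertex , v) (facet , f) (edge , r₁ c)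
        between-r₁c = refl , (s≤s z≤n , r₁ c , Reach-snoc c₁ (λ ()) v∼c , here)
                           , (s≤s (s≤s z≤n) , r₁ c , here , Reach-snoc c₁ (λ ()) f∼c)

    maxChain-flagged : ∀ Φ → ∃ λ x → SameChain M Φ (flagChain x)
    maxChain-flagged Φ with chain Φ vertex facet (s≤s z≤n)
    ... | _ , c , v∼c , f∼c with diamond v∼c f∼c (chain Φ vertex edge (s≤s z≤n)) (chain Φ edge facet (s≤s (s≤s z≤n)))
    ... | inj₁ e∼c = c , λ { bottom → refl , ∼-bottom _ _
                           ; vertex → refl , v∼c
                           ; edge → refl , e∼c
                           ; facet → refl , f∼c
                           ; top → refl , ∼-top _ _ }
    ... | inj₂ e∼r₁c = r₁ c , λ { bottom → refl , ∼-bottom _ _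
                                ; vertex → refl , Reach-snoc c₁ (λ ()) v∼c
                                ; edge → refl , e∼r₁c
                                ; facet → refl , Reach-snoc c₁ (λ ()) f∼c
                                ; top → refl , ∼-top _ _ }

    vertex∩edge : ∀ {x y} → x ∼[ vertex ] y → x ∼[ edge ] y → y ≡ x ⊎ y ≡ r₂ x
    vertex∩edge {x} x∼ᵛy x∼ᵉy with edge-flags x∼ᵉy
    ... | inj₁ y≡x = inj₁ y≡x
    ... | inj₂ (inj₁ refl) = ⊥-elim (vertex-separates x x∼ᵛy)
    ... | inj₂ (inj₂ (inj₁ y≡r₂x)) = inj₂ y≡r₂x
    ... | inj₂ (inj₂ (inj₂ refl)) =
      ⊥-elim (vertex-separates x (subst (x ∼[ vertex ]_) (invol c₂ _) (Reach-snoc c₂ (λ ()) x∼ᵛy)))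

    edge∩facet : ∀ {x y} → x ∼[ edge ] y → x ∼[ facet ] y → y ≡ x ⊎ y ≡ r₀ x
    edge∩facet {x} x∼ᵉy x∼ᶠy with edge-flags x∼ᵉy
    ... | inj₁ y≡x = inj₁ y≡x
    ... | inj₂ (inj₁ y≡r₀x) = inj₂ y≡r₀x
    ... | inj₂ (inj₂ (inj₁ refl)) = ⊥-elim (facet-separates x x∼ᶠy)
    ... | inj₂ (inj₂ (inj₂ refl)) =
      ⊥-elim (facet-separates x (subst (x ∼[ facet ]_) (trans (cong r₀ (r₀r₂-comm x)) (invol c₀ _))
                                       (Reach-snoc c₀ (λ ()) x∼ᶠy)))

    vertex∩facet : ∀ {x y} → x ∼[ vertex ] y → ¬ x ∼[ edge ] y → x ∼[ facet ] y → y ≡ r₁ x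
    vertex∩facet {x} {y} x∼ᵛy x≁ᵉy x∼ᶠy
      with diamond here here (s≤s z≤n , y , x∼ᵛy , here) (s≤s (s≤s z≤n) , y , here , x∼ᶠy)
    ... | inj₁ y∼ᵉx = ⊥-elim (x≁ᵉy (∼-sym y∼ᵉx))
    ... | inj₂ y∼ᵉr₁x with vertex∩edge (Reach-trans (∼-sym (step c₁ (λ ()) here)) x∼ᵛy) (∼-sym y∼ᵉr₁x)
    ...   | inj₁ y≡r₁x = y≡r₁x
    ...   | inj₂ refl = ⊥-elim (facet-separates (r₁ x) (Reach-trans (∼-sym (step c₁ (λ ()) here)) x∼ᶠy))

    commonFacesWalk : ∀ x y → CommonFacesWalk x y
    commonFacesWalk x y with vertex? x y | edge? x y | facet? x y
    ... | yes x∼ᵛy | yes x∼ᵉy | _ =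
      equalOrAdjacent⇒commonFacesWalk separating c₂ (vertex∩edge x∼ᵛy x∼ᵉy)
    ... | no _ | yes x∼ᵉy | yes x∼ᶠy =
      equalOrAdjacent⇒commonFacesWalk separating c₀ (edge∩facet x∼ᵉy x∼ᶠy)
    ... | yes x∼ᵛy | no x≁ᵉy | yes x∼ᶠy =
      equalOrAdjacent⇒commonFacesWalk separating c₁ (inj₂ (vertex∩facet x∼ᵛy x≁ᵉy x∼ᶠy))
    ... | yes x∼ᵛy | no x≁ᵉy | no x≁ᶠy =
      splitColours⇒commonFacesWalk (λ { c₀ ¬allowed → ⊥-elim (¬allowed refl) ; c₁ _ → x≁ᵉy ; c₂ _ → x≁ᶠy }) x∼ᵛy
    ... | no x≁ᵛy | yes x∼ᵉy | no x≁ᶠy =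
      splitColours⇒commonFacesWalk (λ { c₀ _ → x≁ᵛy ; c₁ ¬allowed → ⊥-elim (¬allowed refl) ; c₂ _ → x≁ᶠy }) x∼ᵉy
    ... | no x≁ᵛy | no x≁ᵉy | yes x∼ᶠy =
      splitColours⇒commonFacesWalk (λ { c₀ _ → x≁ᵛy ; c₁ _ → x≁ᵉy ; c₂ ¬allowed → ⊥-elim (¬allowed refl) }) x∼ᶠy
    ... | no x≁ᵛy | no x≁ᵉy | no x≁ᶠy =
      splitColours⇒commonFacesWalk (λ { c₀ _ → x≁ᵛy ; c₁ _ → x≁ᵉy ; c₂ _ → x≁ᶠy }) (connected x y)

    thin⇒stronglyConnected : StronglyConnected M
    thin⇒stronglyConnected = flagWalks⇒stronglyConnected separating maxChain-flagged commonFacesWalk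

lemma2 : (M : Maniplex 3) → Faithful M → Thin M → Polytopal M
lemma2 M _ thin = thin , Rank3.thin⇒stronglyConnected M thin
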